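{- Consider Caching in Matchings where the online algorithm has $k+h$ matchings and the offline optimum has $k$ matchings, with $h\ge k-1$. Then there is a deterministic online algorithm that is $2\left(1+\frac{k-1}{\lfloor (h+3-k)/2\rfloor}\right)$-competitive. In particular, with $h=(1+\alpha)k$ extra matchings (for $\alpha>0$) the competitive ratio is $O(1+\frac{1}{\alpha})$.
   Context: Caching in Matchings with resource augmentation (general graphs): on a node set of size $n$, requests for edges arrive online. The online algorithm maintains a cache which is the union of $k+h$ matchings (a properly $(k+h)$-edge-colored edge set). If a requested edge is in none of its matchings, it must insert it into one of them, evicting from that matching the edges incident to its endpoints; it may also add any edge to any matching at any time (keeping each a matching) and evict freely. Each addition of an edge to a matching costs $1$. The offline optimum $OPT$ solves the same problem with only $k$ matchings. An online algorithm $A$ is $c$-competitive if there is a constant $d$ (independent of the sequence) with $\mathrm{cost}(A(\sigma))\le c\cdot\mathrm{cost}(OPT(\sigma))+d$ for every request sequence $\sigma$. -}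

module Defs where

open import Data.Nat using (ℕ; zero; suc; _+_)
open import Data.Fin using (Fin; zero; suc; _<?_)
open import Data.Fin.Properties using () renaming (_≟_ to _≟F_)
open import Data.Maybe using (Maybe; just; nothing)
open import Data.Maybe.Properties using (≡-dec)
open import Data.Product using (Σ; _×_; _,_; proj₁; proj₂; ∃-syntax)
open import Data.List using (List; []; _∷_)
open import Data.List.Relation.Binary.Pointwise using (Pointwise)
open import Data.Bool using (Bool; true; false; _∧_; not; if_then_else_)
open import Relation.Nullary using (does)
open import Relation.Binary.PropositionalEquality using (_≡_; _≢_)

sumFin : (k : ℕ) → (Fin k → ℕ) → ℕ
sumFin zero    f = 0
sumFin (suc k) f = f zero + sumFin k (λ i → f (suc i))

-- A (candidate) matching on node set Fin n, given by its partner map: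
-- M u ≡ just v means the edge {u,v} is in the matching.
PartnerMap : ℕ → Set
PartnerMap n = Fin n → Maybe (Fin n)

IsMatching : {n : ℕ} → PartnerMap n → Set
IsMatching {n} M = (u v : Fin n) → M u ≡ just v → (u ≢ v) × (M v ≡ just u)

Cache : ℕ → ℕ → Set
Cache m n = Fin m → PartnerMap n

ValidCache : {m n : ℕ} → Cache m n → Set
ValidCache {m} C = (c : Fin m) → IsMatching (C c)

emptyCache : {m n : ℕ} → Cache m n
emptyCache _ _ = nothing

Edge : ℕ → Set
Edge n = Σ (Fin n × Fin n) (λ p → proj₁ p ≢ proj₂ p)

Serves : {m n : ℕ} → Cache m n → Edge n → Set
Serves {m} C ((u , v) , _) = ∃[ c ] (C c u ≡ just v)

-- Number of (colour, edge) pairs in C' but not in C: the cost of moving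
-- from C to C' (each addition of an edge to a matching costs 1; evictions free).
added : {m n : ℕ} → Cache m n → Cache m n → ℕ
added {m} {n} C C' =
  sumFin m λ c → sumFin n λ u → sumFin n λ v →
    if does (u <? v) ∧ does (≡-dec _≟F_ (C' c u) (just v))
         ∧ not (does (≡-dec _≟F_ (C c u) (just v)))
    then 1 else 0

schedCost : {m n : ℕ} → Cache m n → List (Cache m n) → ℕ
schedCost prev []       = 0
schedCost prev (C ∷ Cs) = added prev C + schedCost C Cs

-- A feasible (offline) schedule for a request sequence: one cache state per
-- request (the state at the time the request is served), each a union of
-- matchings containing the requested edge.
FeasibleSched : {m n : ℕ} → List (Edge n) → List (Cache m n) → Set
FeasibleSched σ S = Pointwise (λ r C → ValidCache C × Serves C r) σ S

-- A deterministic online algorithm: given the requests so far (most recent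
-- first, including the current one) it returns its cache state after
-- serving the current request.
OnlineAlg : ℕ → ℕ → Set
OnlineAlg m n = List (Edge n) → Cache m n

IsOnlineAlg : {m n : ℕ} → OnlineAlg m n → Set
IsOnlineAlg {m} {n} A =
  (r : Edge n) (hist : List (Edge n)) →
    ValidCache (A (r ∷ hist)) × Serves (A (r ∷ hist)) r

onlineStates : {m n : ℕ} → OnlineAlg m n → List (Edge n) → List (Edge n) → List (Cache m n)
onlineStates A hist []       = []
onlineStates A hist (r ∷ rs) = A (r ∷ hist) ∷ onlineStates A (r ∷ hist) rs

onlineCost : {m n : ℕ} → OnlineAlg m n → List (Edge n) → ℕ
onlineCost A σ = schedCost emptyCache (onlineStates A [] σ)

{-# OPTIONS --safe #-}
-- Every node keeps a list of at most K = f + k − 1 requested neighbours, f = ⌊(h + 3 − k)/2⌋: a request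
-- {u, v} adds v to the list of u and u to that of v, a full list being flushed to the new entry alone.
-- The cache holds exactly the edges lying in both lists of their endpoints, each in one matching. On a
-- fault each endpoint has at most K − 1 other cached edges and 2K ≤ k + h + 1, so some matching is free
-- at both endpoints and the fault costs one, which is paid by a list insertion.
-- A list that is flushed has received K + 1 ≥ f + k distinct neighbours since its previous flush, and at
-- that flush the offline cache held at most k of them: the offline algorithm has meanwhile gained at least
-- f new neighbours of the node. The potential K · (unpaid new offline neighbours) − f · (list size) turns
-- this into f per insertion against K per new offline neighbour, and each edge the offline algorithm adds
-- gives two new neighbours, so f · cost ≤ 2K · OPT + f n K.
module Submission where

open import Defs
open import Data.Bool using (Bool; true; false; _∧_; _∨_; not; if_then_else_; T)
open import Data.Bool.Properties using (∨-zeroʳ; ∧-zeroʳ; ∧-inverseʳ; ∧-comm; ∧-conicalˡ; ∧-conicalʳ; ∧-identityʳ; not-injective; ⇔→≡)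
open import Data.Empty using (⊥-elim)
open import Data.Fin using (Fin; zero; suc; _<?_)
open import Data.Fin.Properties using (_≟_; any?; <-cmp; <-asym)
open import Data.List using (List; []; _∷_)
open import Data.List.Relation.Binary.Pointwise using ([]; _∷_)
open import Data.Maybe using (Maybe; just; nothing; is-just)
open import Data.Maybe.Properties using (≡-dec; just-injective)
open import Data.Nat using (ℕ; zero; suc; _+_; _*_; _∸_; _≤_; _<ᵇ_; z≤n; s≤s; ⌊_/2⌋)
open import Data.Nat.Properties hiding (_≟_; _<?_; <-cmp; <-asym)
open import Data.Nat.Solver using (module +-*-Solver)
open import Algebra.Properties.Semiring.Sum +-*-semiring
  using (sum; sum-syntax; sum-cong-≗; sum-replicate-zero; ∑-distrib-+; ∑-comm; *-distribˡ-sum)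
open import Data.Product using (Σ; _×_; _,_; proj₁; proj₂; ∃-syntax)
open import Data.Sum using (_⊎_; inj₁; inj₂)
open import Function using (_∘_; id; mk⇔)
open import Relation.Binary using (tri<; tri≈; tri>)
open import Relation.Binary.PropositionalEquality
open import Relation.Binary.Definitions using (DecidableEquality)
open import Relation.Unary using (Decidable)
open import Relation.Nullary using (Dec; does; yes; no; ¬_)
open import Relation.Nullary.Decidable using (dec-true; dec-false; _×-dec_; _⊎-dec_)

does-true : ∀ {a} {A : Set a} (d : Dec A) → does d ≡ true → A
does-true (yes a) _ = a

does-false : ∀ {a} {A : Set a} (d : Dec A) → does d ≡ false → ¬ A
does-false (no ¬a) _ = ¬a

𝟙 : Bool → ℕ
𝟙 b = if b then 1 else 0

𝟙≤1 : ∀ b → 𝟙 b ≤ 1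
𝟙≤1 true  = ≤-refl
𝟙≤1 false = z≤n

sumFin≡sum : ∀ k (f : Fin k → ℕ) → sumFin k f ≡ sum f
sumFin≡sum zero    f = refl
sumFin≡sum (suc k) f = cong (f zero +_) (sumFin≡sum k (f ∘ suc))

sum-mono-≤ : ∀ {k} {f g : Fin k → ℕ} → (∀ i → f i ≤ g i) → sum f ≤ sum g
sum-mono-≤ {zero}  f≤g = z≤n
sum-mono-≤ {suc k} f≤g = +-mono-≤ (f≤g zero) (sum-mono-≤ (f≤g ∘ suc))

≤-sum : ∀ {k} (f : Fin k → ℕ) i → f i ≤ sum f
≤-sum f zero    = m≤m+n _ _
≤-sum f (suc i) = ≤-trans (≤-sum (f ∘ suc) i) (m≤n+m _ _)

sum-zero : ∀ {k} {f : Fin k → ℕ} → (∀ i → f i ≡ 0) → sum f ≡ 0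
sum-zero {k} f≡0 = trans (sum-cong-≗ f≡0) (sum-replicate-zero k)

sum-const : ∀ k c → ∑[ i < k ] c ≡ k * c
sum-const zero    c = refl
sum-const (suc k) c = cong (c +_) (sum-const k c)

sum-supported : ∀ {k} (f : Fin k → ℕ) a → (∀ i → i ≢ a → f i ≡ 0) → sum f ≡ f a
sum-supported {suc k} f zero    off = begin
  f zero + ∑[ i < k ] f (suc i) ≡⟨ cong (f zero +_) (sum-zero (λ i → off (suc i) λ ())) ⟩
  f zero + 0                    ≡⟨ +-identityʳ (f zero) ⟩
  f zero                        ∎
  where open ≡-Reasoning
sum-supported {suc k} f (suc a) off =
  cong₂ _+_ (off zero λ ()) (sum-supported (f ∘ suc) a (λ i i≢a → off (suc i) λ { refl → i≢a refl }))

sum-linear₃ : ∀ {k} (a b c : Fin k → ℕ) p q r →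
  ∑[ x < k ] (p * a x + q * b x + r * c x) ≡ p * sum a + q * sum b + r * sum c
sum-linear₃ {k} a b c p q r = begin
  ∑[ x < k ] (p * a x + q * b x + r * c x)
    ≡⟨ ∑-distrib-+ (λ x → p * a x + q * b x) (λ x → r * c x) ⟩
  ∑[ x < k ] (p * a x + q * b x) + ∑[ x < k ] (r * c x)
    ≡⟨ cong₂ _+_ (∑-distrib-+ (λ x → p * a x) (λ x → q * b x)) (sym (*-distribˡ-sum r c)) ⟩
  ∑[ x < k ] (p * a x) + ∑[ x < k ] (q * b x) + r * sum c
    ≡⟨ cong (_+ r * sum c) (cong₂ _+_ (sym (*-distribˡ-sum p a)) (sym (*-distribˡ-sum q b))) ⟩
  p * sum a + q * sum b + r * sum c ∎
  where open ≡-Reasoning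

sum-𝟙≤𝟙 : ∀ {k} (g : Fin k → Bool) b → ∑[ i < k ] 𝟙 (g i) ≤ 1 → (∀ i → g i ≡ true → b ≡ true) →
          ∑[ i < k ] 𝟙 (g i) ≤ 𝟙 b
sum-𝟙≤𝟙 g true  sum≤1 _    = sum≤1
sum-𝟙≤𝟙 g false _     g⇒b = ≤-reflexive (sum-zero 𝟙-g≡0)
  where
  𝟙-g≡0 : ∀ i → 𝟙 (g i) ≡ 0
  𝟙-g≡0 i with g i in gi
  ... | false = refl
  ... | true with () ← g⇒b i gi

_==_ : ∀ {n} → Fin n → Fin n → Bool
a == b = does (a ≟ b)

==-refl : ∀ {n} (a : Fin n) → (a == a) ≡ true
==-refl a = dec-true (a ≟ a) refl

==-sound : ∀ {n} {a b : Fin n} → (a == b) ≡ true → a ≡ b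
==-sound {a = a} {b} = does-true (a ≟ b)

==-false : ∀ {n} {a b : Fin n} → a ≢ b → (a == b) ≡ false
==-false {a = a} {b} = dec-false (a ≟ b)

Subset : ℕ → Set
Subset n = Fin n → Bool

module _ {n : ℕ} where

  infixl 6 _∪_
  infixl 7 _∩_ _∖_
  infix 4 _⊆_

  ∅ : Subset n
  ∅ _ = false

  ⁅_⁆ : Fin n → Subset n
  ⁅ y ⁆ w = w == y

  _∪_ _∩_ _∖_ : Subset n → Subset n → Subset n
  (A ∪ B) w = A w ∨ B w
  (A ∩ B) w = A w ∧ B w
  (A ∖ B) w = A w ∧ not (B w)

  _⊆_ : Subset n → Subset n → Set
  A ⊆ B = ∀ w → A w ≡ true → B w ≡ true

  ⊆-refl : ∀ {A} → A ⊆ A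
  ⊆-refl _ = id

  size : Subset n → ℕ
  size A = ∑[ w < n ] 𝟙 (A w)

  ⊆-∪ˡ : ∀ {A B C} → A ⊆ B → A ⊆ B ∪ C
  ⊆-∪ˡ A⊆B w w∈A rewrite A⊆B w w∈A = refl

  ⊆-∪ʳ : ∀ {A B C} → A ⊆ C → A ⊆ B ∪ C
  ⊆-∪ʳ {B = B} A⊆C w w∈A rewrite A⊆C w w∈A = ∨-zeroʳ (B w)

  ∪-⊆ : ∀ {A B C} → A ⊆ C → B ⊆ C → A ∪ B ⊆ C
  ∪-⊆ {A} A⊆C B⊆C w w∈A∪B with A w in eA
  ... | true  = A⊆C w eA
  ... | false = B⊆C w w∈A∪B

  ⊆-∖-∪ : ∀ {A B C} → A ⊆ B → A ⊆ B ∖ C ∪ C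
  ⊆-∖-∪ {C = C} A⊆B w w∈A with C w | A⊆B w w∈A
  ... | true  | _   = ∨-zeroʳ _
  ... | false | w∈B rewrite w∈B = refl

  ∪-⁅⁆-elim : ∀ A {y} w → (A ∪ ⁅ y ⁆) w ≡ true → A w ≡ true ⊎ w ≡ y
  ∪-⁅⁆-elim A w w∈ with A w
  ... | true  = inj₁ refl
  ... | false = inj₂ (==-sound w∈)

  ⁅⁆-⊆ : ∀ {A y} → A y ≡ true → ⁅ y ⁆ ⊆ A
  ⁅⁆-⊆ {A} y∈A w w≡y = subst (λ z → A z ≡ true) (sym (==-sound w≡y)) y∈A

  size-mono : ∀ {A B} → A ⊆ B → size A ≤ size B
  size-mono {A} {B} A⊆B = sum-mono-≤ 𝟙-mono
    where
    𝟙-mono : ∀ w → 𝟙 (A w) ≤ 𝟙 (B w)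
    𝟙-mono w with A w in eq
    ... | false = z≤n
    ... | true rewrite A⊆B w eq = ≤-refl

  size-∪-∩ : ∀ A B → size (A ∪ B) + size (A ∩ B) ≡ size A + size B
  size-∪-∩ A B = begin
    size (A ∪ B) + size (A ∩ B)               ≡⟨ ∑-distrib-+ (𝟙 ∘ (A ∪ B)) (𝟙 ∘ (A ∩ B)) ⟨
    ∑[ w < n ] (𝟙 (A w ∨ B w) + 𝟙 (A w ∧ B w)) ≡⟨ sum-cong-≗ (λ w → 𝟙-∨-∧ (A w) (B w)) ⟩
    ∑[ w < n ] (𝟙 (A w) + 𝟙 (B w))            ≡⟨ ∑-distrib-+ (𝟙 ∘ A) (𝟙 ∘ B) ⟩
    size A + size B                           ∎
    where
    open ≡-Reasoning
    𝟙-∨-∧ : ∀ a b → 𝟙 (a ∨ b) + 𝟙 (a ∧ b) ≡ 𝟙 a + 𝟙 b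
    𝟙-∨-∧ true  true  = refl
    𝟙-∨-∧ true  false = refl
    𝟙-∨-∧ false true  = refl
    𝟙-∨-∧ false false = refl

  size-∪ : ∀ A B → size (A ∪ B) ≤ size A + size B
  size-∪ A B = ≤-trans (m≤m+n _ _) (≤-reflexive (size-∪-∩ A B))

  size-⊆-∪ : ∀ {A B C} → A ⊆ B ∪ C → size A ≤ size B + size C
  size-⊆-∪ {B = B} {C} A⊆B∪C = ≤-trans (size-mono A⊆B∪C) (size-∪ B C)

  size-∅ : size ∅ ≡ 0
  size-∅ = sum-zero {n} λ _ → refl

  size-∖-self : ∀ A → size (A ∖ A) ≡ 0
  size-∖-self A = sum-zero {n} (λ w → cong 𝟙 (∧-inverseʳ (A w)))

  size-⁅⁆ : ∀ y → size ⁅ y ⁆ ≡ 1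
  size-⁅⁆ y = trans (sum-supported (𝟙 ∘ ⁅ y ⁆) y (λ w w≢y → cong 𝟙 (==-false w≢y))) (cong 𝟙 (==-refl y))

  size-∪-⁅⁆ : ∀ A y → A y ≡ false → size (A ∪ ⁅ y ⁆) ≡ size A + 1
  size-∪-⁅⁆ A y y∉A = begin
    size (A ∪ ⁅ y ⁆)                      ≡⟨ +-identityʳ _ ⟨
    size (A ∪ ⁅ y ⁆) + 0                  ≡⟨ cong (size (A ∪ ⁅ y ⁆) +_) (sum-zero disjoint) ⟨
    size (A ∪ ⁅ y ⁆) + size (A ∩ ⁅ y ⁆)   ≡⟨ size-∪-∩ A ⁅ y ⁆ ⟩
    size A + size ⁅ y ⁆                   ≡⟨ cong (size A +_) (size-⁅⁆ y) ⟩
    size A + 1                            ∎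
    where
    open ≡-Reasoning
    disjoint : ∀ w → 𝟙 ((A ∩ ⁅ y ⁆) w) ≡ 0
    disjoint w with w ≟ y
    ... | yes refl rewrite y∉A = refl
    ... | no _ rewrite ∧-zeroʳ (A w) = refl

  size-∖-⁅⁆ : ∀ A v → A v ≡ true → size (A ∖ ⁅ v ⁆) + 1 ≤ size A
  size-∖-⁅⁆ A v v∈A = begin
    size (A ∖ ⁅ v ⁆) + 1       ≡⟨ size-∪-⁅⁆ (A ∖ ⁅ v ⁆) v v∉A∖v ⟨
    size (A ∖ ⁅ v ⁆ ∪ ⁅ v ⁆)   ≤⟨ size-mono ⊆A ⟩
    size A                     ∎
    where
    open ≤-Reasoning
    v∉A∖v : A v ∧ not (v == v) ≡ false
    v∉A∖v rewrite ==-refl v = ∧-zeroʳ (A v)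
    ⊆A : A ∖ ⁅ v ⁆ ∪ ⁅ v ⁆ ⊆ A
    ⊆A w _ with w ≟ v
    ⊆A w _  | yes refl = v∈A
    ⊆A w w∈ | no _ with A w
    ... | true = refl

_≟ₘ_ : ∀ {n} → DecidableEquality (Maybe (Fin n))
_≟ₘ_ = ≡-dec _≟_

_≐_ : ∀ {n} → Maybe (Fin n) → Fin n → Bool
mx ≐ w = does (mx ≟ₘ just w)

module _ {n : ℕ} {mx : Maybe (Fin n)} {w : Fin n} where

  ≐-sound : (mx ≐ w) ≡ true → mx ≡ just w
  ≐-sound = does-true (mx ≟ₘ just w)

  ≐-complete : mx ≡ just w → (mx ≐ w) ≡ true
  ≐-complete = dec-true (mx ≟ₘ just w)

  ≐-false : mx ≢ just w → (mx ≐ w) ≡ false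
  ≐-false = dec-false (mx ≟ₘ just w)

sum-≐ : ∀ {n} (mx : Maybe (Fin n)) → ∑[ w < n ] 𝟙 (mx ≐ w) ≡ 𝟙 (is-just mx)
sum-≐ {n} nothing = sum-zero {n} (λ w → refl)
sum-≐ (just y)    = trans (sum-supported (𝟙 ∘ (just y ≐_)) y off) (cong 𝟙 (≐-complete {mx = just y} refl))
  where
  off : ∀ w → w ≢ y → 𝟙 (just y ≐ w) ≡ 0
  off w w≢y = cong 𝟙 (≐-false (w≢y ∘ sym ∘ just-injective))

≐-sym : ∀ {m n} {C : Cache m n} → ValidCache C → ∀ c x w → (C c x ≐ w) ≡ (C c w ≐ x)
≐-sym {C = C} valid c x w with C c x ≐ w in e₁ | C c w ≐ x in e₂
... | true  | true  = refl
... | false | false = refl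
... | true  | false = sym (trans (sym e₂) (≐-complete (proj₂ (valid c x w (≐-sound e₁)))))
... | false | true  = trans (sym e₁) (≐-complete (proj₂ (valid c w x (≐-sound e₂))))

adj : ∀ {m n} → Cache m n → Fin n → Subset n
adj C x w = does (any? λ c → C c x ≟ₘ just w)

module _ {m n : ℕ} (C : Cache m n) {x w : Fin n} where

  adj-intro : ∀ c → C c x ≡ just w → adj C x w ≡ true
  adj-intro c e = dec-true (any? _) (c , e)

  adj-elim : adj C x w ≡ true → ∃[ c ] C c x ≡ just w
  adj-elim = does-true (any? _)

  adj-false : adj C x w ≡ false → ∀ c → C c x ≢ just w
  adj-false e c e′ = does-false (any? _) e (c , e′)

  𝟙-adj≤ : 𝟙 (adj C x w) ≤ ∑[ c < m ] 𝟙 (C c x ≐ w)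
  𝟙-adj≤ with adj C x w in e
  ... | false = z≤n
  ... | true with c , p ← adj-elim e = ≤-trans (≤-reflexive (cong 𝟙 (sym (≐-complete p)))) (≤-sum _ c)

adj-empty : ∀ {m n} (x w : Fin n) → adj (emptyCache {m}) x w ≡ false
adj-empty {m} x w = dec-false (any? λ c → emptyCache {m} c x ≟ₘ just w) λ ()

size-adj≤ : ∀ {m n} (C : Cache m n) x → size (adj C x) ≤ m
size-adj≤ {m} {n} C x = begin
  size (adj C x)                             ≤⟨ sum-mono-≤ (λ w → 𝟙-adj≤ C {x} {w}) ⟩
  ∑[ w < n ] ∑[ c < m ] 𝟙 (C c x ≐ w)        ≡⟨ ∑-comm (λ w c → 𝟙 (C c x ≐ w)) ⟩
  ∑[ c < m ] ∑[ w < n ] 𝟙 (C c x ≐ w)        ≡⟨ sum-cong-≗ (λ c → sum-≐ (C c x)) ⟩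
  ∑[ c < m ] 𝟙 (is-just (C c x))             ≤⟨ sum-mono-≤ (λ c → 𝟙≤1 (is-just (C c x))) ⟩
  ∑[ c < m ] 1                               ≡⟨ sum-const m 1 ⟩
  m * 1                                      ≡⟨ *-identityʳ m ⟩
  m                                          ∎
  where open ≤-Reasoning

-- New neighbours gained by an offline schedule

newNbrs : ∀ {m n} → Cache m n → Cache m n → Fin n → Subset n
newNbrs P C x = adj C x ∖ adj P x

added≡sum : ∀ {m n} (P C : Cache m n) →
  added P C ≡ ∑[ c < m ] ∑[ x < n ] ∑[ w < n ] 𝟙 (does (x <? w) ∧ (C c x ≐ w) ∧ not (P c x ≐ w))
added≡sum {m} {n} P C =
  trans (sumFin≡sum m _) (sum-cong-≗ {m} λ c → trans (sumFin≡sum n _) (sum-cong-≗ {n} λ x → sumFin≡sum n _))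

added-self : ∀ {m n} (C : Cache m n) → added C C ≡ 0
added-self {m} {n} C = trans (added≡sum C C) (sum-zero λ c → sum-zero λ x → sum-zero λ y →
  trans (cong (λ b → 𝟙 (does (x <? y) ∧ b)) (∧-inverseʳ (C c x ≐ y))) (cong 𝟙 (∧-zeroʳ (does (x <? y)))))

module _ {m n : ℕ} {P C : Cache m n} (validP : ValidCache P) (validC : ValidCache C) where

  private
    gained : Fin m → Fin n → Fin n → Bool
    gained c x w = (C c x ≐ w) ∧ not (P c x ≐ w)

    gained< : Fin m → Fin n → Fin n → ℕ
    gained< c x w = 𝟙 (does (x <? w) ∧ gained c x w)

    𝟙-newNbrs≤ : ∀ x w → 𝟙 (newNbrs P C x w) ≤ ∑[ c < m ] 𝟙 (gained c x w)
    𝟙-newNbrs≤ x w with adj C x w in e₁ | adj P x w in e₂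
    ... | false | _    = z≤n
    ... | true  | true = z≤n
    ... | true  | false with c , p ← adj-elim C e₁ =
      ≤-trans (≤-reflexive (cong 𝟙 (sym gained-c))) (≤-sum (λ c → 𝟙 (gained c x w)) c)
      where
      gained-c : gained c x w ≡ true
      gained-c rewrite ≐-complete p | ≐-false (adj-false P e₂ c) = refl

    𝟙-gained≤ : ∀ c x w → 𝟙 (gained c x w) ≤ gained< c x w + gained< c w x
    𝟙-gained≤ c x w with C c x ≐ w in e₁ | P c x ≐ w in e₂
    ... | false | _    = z≤n
    ... | true  | true = z≤n
    ... | true  | false rewrite sym (≐-sym validC c x w) | sym (≐-sym validP c x w) | e₁ | e₂
        with <-cmp x w
    ... | tri< x<w _ _ rewrite dec-true (x <? w) x<w = s≤s z≤n
    ... | tri> _ _ w<x rewrite dec-true (w <? x) w<x = m≤n+m _ _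
    ... | tri≈ _ refl _ = ⊥-elim (proj₁ (validC c x x (≐-sound e₁)) refl)

    sum-gained-sym : ∀ c → ∑[ x < n ] ∑[ w < n ] (gained< c x w + gained< c w x)
                         ≡ 2 * ∑[ x < n ] ∑[ w < n ] gained< c x w
    sum-gained-sym c = begin
      ∑[ x < n ] ∑[ w < n ] (gained< c x w + gained< c w x)
        ≡⟨ sum-cong-≗ (λ x → ∑-distrib-+ (gained< c x) (λ w → gained< c w x)) ⟩
      ∑[ x < n ] (∑[ w < n ] gained< c x w + ∑[ w < n ] gained< c w x)
        ≡⟨ ∑-distrib-+ (λ x → ∑[ w < n ] gained< c x w) (λ x → ∑[ w < n ] gained< c w x) ⟩
      G + ∑[ x < n ] ∑[ w < n ] gained< c w x
        ≡⟨ cong (G +_) (∑-comm (λ x w → gained< c w x)) ⟩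
      G + G
        ≡⟨ cong (G +_) (+-identityʳ G) ⟨
      2 * G ∎
      where
      open ≡-Reasoning
      G = ∑[ x < n ] ∑[ w < n ] gained< c x w

  sum-size-newNbrs≤ : ∑[ x < n ] size (newNbrs P C x) ≤ 2 * added P C
  sum-size-newNbrs≤ = begin
    ∑[ x < n ] ∑[ w < n ] 𝟙 (newNbrs P C x w)
      ≤⟨ sum-mono-≤ (λ x → sum-mono-≤ (𝟙-newNbrs≤ x)) ⟩
    ∑[ x < n ] ∑[ w < n ] ∑[ c < m ] 𝟙 (gained c x w)
      ≡⟨ sum-cong-≗ (λ x → ∑-comm (λ w c → 𝟙 (gained c x w))) ⟩
    ∑[ x < n ] ∑[ c < m ] ∑[ w < n ] 𝟙 (gained c x w)
      ≡⟨ ∑-comm (λ x c → ∑[ w < n ] 𝟙 (gained c x w)) ⟩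
    ∑[ c < m ] ∑[ x < n ] ∑[ w < n ] 𝟙 (gained c x w)
      ≤⟨ sum-mono-≤ (λ c → sum-mono-≤ (λ x → sum-mono-≤ (𝟙-gained≤ c x))) ⟩
    ∑[ c < m ] ∑[ x < n ] ∑[ w < n ] (gained< c x w + gained< c w x)
      ≡⟨ sum-cong-≗ sum-gained-sym ⟩
    ∑[ c < m ] (2 * ∑[ x < n ] ∑[ w < n ] gained< c x w)
      ≡⟨ *-distribˡ-sum 2 (λ c → ∑[ x < n ] ∑[ w < n ] gained< c x w) ⟨
    2 * ∑[ c < m ] ∑[ x < n ] ∑[ w < n ] gained< c x w
      ≡⟨ cong (2 *_) (added≡sum P C) ⟨
    2 * added P C ∎
    where open ≤-Reasoning

-- Lists of requested neighbours, flushed when full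

push : ∀ {n} → ℕ → Subset n → Fin n → Subset n
push K R y = if size R <ᵇ K then R ∪ ⁅ y ⁆ else ⁅ y ⁆

module _ {n : ℕ} (K : ℕ) (R : Subset n) (y : Fin n) where

  push-∋ : push K R y y ≡ true
  push-∋ with size R <ᵇ K
  ... | true  = trans (cong (R y ∨_) (==-refl y)) (∨-zeroʳ (R y))
  ... | false = ==-refl y

  push-⊆ : push K R y ⊆ R ∪ ⁅ y ⁆
  push-⊆ with size R <ᵇ K
  ... | true  = ⊆-refl
  ... | false = ⊆-∪ʳ ⊆-refl

  size-push≤ : 1 ≤ K → size R ≤ K → size (push K R y) ≤ K
  size-push≤ 1≤K _ with size R <ᵇ K in lt
  ... | true  = begin
    size (R ∪ ⁅ y ⁆)    ≤⟨ size-∪ R ⁅ y ⁆ ⟩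
    size R + size ⁅ y ⁆ ≡⟨ cong (size R +_) (size-⁅⁆ y) ⟩
    size R + 1          ≡⟨ +-comm (size R) 1 ⟩
    suc (size R)        ≤⟨ <ᵇ⇒< (size R) K (subst T (sym lt) _) ⟩
    K                   ∎
    where open ≤-Reasoning
  ... | false = ≤-trans (≤-reflexive (size-⁅⁆ y)) 1≤K

-- Analysis-only state of a node: base holds its offline neighbours at the last flush, and seen every
-- neighbour that has since been requested at it or been offline-adjacent to it.
record Ghost (n : ℕ) : Set where
  constructor ghost
  field
    base seen : Subset n

open Ghost

module _ {n : ℕ} where

  unpaid : Ghost n → ℕ
  unpaid g = size (seen g ∖ base g)

  grow : Ghost n → Subset n → Ghost n
  grow g O = ghost (base g) (seen g ∪ O)

  Tracks : ℕ → Subset n → Subset n → Ghost n → Set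
  Tracks k R O g = R ⊆ seen g × O ⊆ seen g × size (base g) ≤ k

  unpaid-grow≤ : ∀ {O} g O′ → O ⊆ seen g → unpaid (grow g O′) ≤ unpaid g + size (O′ ∖ O)
  unpaid-grow≤ {O} g O′ O⊆seen = size-⊆-∪ split
    where
    split : (seen g ∪ O′) ∖ base g ⊆ (seen g ∖ base g) ∪ (O′ ∖ O)
    split w w∈ with seen g w in eS | base g w | O′ w | O w in eO
    split w () | true  | true  | _     | _
    split w () | false | true  | true  | _
    split w () | false | true  | false | _
    split w () | false | false | false | _
    ... | true  | false | _     | _     = refl
    ... | false | false | true  | false = refl
    ... | false | false | true  | true  with () ← trans (sym eS) (O⊆seen w eO)

-- Amortised says f · ins + ΔΦ ≤ K · size (O′ ∖ O) for the node potential Φ = K · unpaid − f · size R,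
-- written without subtraction.
module Amortisation {n : ℕ} (k K f : ℕ) (f+k≤1+K : f + k ≤ suc K) where

  open +-*-Solver using (solve; _:+_; _:*_; _:=_; con)

  Amortised : (R R′ O O′ : Subset n) → Ghost n → ℕ → Set
  Amortised R R′ O O′ g ins = Σ (Ghost n) λ g′ → Tracks k R′ O′ g′ ×
    f * ins + f * size R + K * unpaid g′ ≤ K * size (O′ ∖ O) + f * size R′ + K * unpaid g

  amortised-idle : ∀ {R O : Subset n} O′ g → Tracks k R O g → Amortised R R O O′ g 0
  amortised-idle {R} {O} O′ g (R⊆seen , O⊆seen , size-base≤k) =
    grow g O′ , (⊆-∪ˡ R⊆seen , ⊆-∪ʳ ⊆-refl , size-base≤k) , (begin
      f * 0 + f * size R + K * unpaid (grow g O′)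
        ≤⟨ +-monoʳ-≤ (f * 0 + f * size R) (*-monoʳ-≤ K (unpaid-grow≤ g O′ O⊆seen)) ⟩
      f * 0 + f * size R + K * (unpaid g + size (O′ ∖ O))
        ≡⟨ solve 5 (λ f r K u d → f :* con 0 :+ f :* r :+ K :* (u :+ d) := K :* d :+ f :* r :+ K :* u)
                 refl f (size R) K (unpaid g) (size (O′ ∖ O)) ⟩
      K * size (O′ ∖ O) + f * size R + K * unpaid g ∎)
    where open ≤-Reasoning

  -- Since the last flush the node has seen at least size R + 1 ≥ f + k distinct requested neighbours,
  -- at most k of which were among the offline neighbours at that flush.
  flush-paid : ∀ {R O O′ : Subset n} {y} g → K ≤ size R → R y ≡ false → O′ y ≡ true → Tracks k R O g →
               f ≤ size (O′ ∖ O) + unpaid g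
  flush-paid {R} {O} {O′} {y} g K≤size y∉R y∈O′ (R⊆seen , O⊆seen , size-base≤k) =
    +-cancelʳ-≤ k f (size (O′ ∖ O) + unpaid g) (begin
      f + k                                 ≤⟨ f+k≤1+K ⟩
      suc K                                 ≤⟨ s≤s K≤size ⟩
      suc (size R)                          ≡⟨ +-comm 1 (size R) ⟩
      size R + 1                            ≡⟨ size-∪-⁅⁆ R y y∉R ⟨
      size (R ∪ ⁅ y ⁆)                      ≤⟨ size-⊆-∪ (⊆-∖-∪ (∪-⊆ (⊆-∪ˡ {C = O′} R⊆seen) (⊆-∪ʳ {B = seen g} (⁅⁆-⊆ y∈O′)))) ⟩
      unpaid (grow g O′) + size (base g)    ≤⟨ +-mono-≤ (unpaid-grow≤ g O′ O⊆seen) size-base≤k ⟩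
      unpaid g + size (O′ ∖ O) + k          ≡⟨ cong (_+ k) (+-comm (unpaid g) (size (O′ ∖ O))) ⟩
      size (O′ ∖ O) + unpaid g + k          ∎)
    where open ≤-Reasoning

  amortised-push : ∀ {R O O′ : Subset n} {y} g → R y ≡ false → O′ y ≡ true → size R ≤ K → size O′ ≤ k →
                   Tracks k R O g → Amortised R (push K R y) O O′ g 1
  amortised-push {R} {O} {O′} {y} g y∉R y∈O′ size-R≤K size-O′≤k tracks@(R⊆seen , O⊆seen , size-base≤k)
    with size R <ᵇ K in lt
  ... | true =
    grow g O′ , (∪-⊆ (⊆-∪ˡ {C = O′} R⊆seen) (⊆-∪ʳ {B = seen g} (⁅⁆-⊆ y∈O′)) , ⊆-∪ʳ ⊆-refl , size-base≤k) , (begin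
      f * 1 + f * size R + K * unpaid (grow g O′)
        ≤⟨ +-monoʳ-≤ (f * 1 + f * size R) (*-monoʳ-≤ K (unpaid-grow≤ g O′ O⊆seen)) ⟩
      f * 1 + f * size R + K * (unpaid g + size (O′ ∖ O))
        ≡⟨ solve 5 (λ f r K u d → f :* con 1 :+ f :* r :+ K :* (u :+ d) := K :* d :+ f :* (r :+ con 1) :+ K :* u)
                 refl f (size R) K (unpaid g) (size (O′ ∖ O)) ⟩
      K * size (O′ ∖ O) + f * (size R + 1) + K * unpaid g
        ≡⟨ cong (λ s → K * size (O′ ∖ O) + f * s + K * unpaid g) (size-∪-⁅⁆ R y y∉R) ⟨
      K * size (O′ ∖ O) + f * size (R ∪ ⁅ y ⁆) + K * unpaid g ∎)
    where open ≤-Reasoning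
  ... | false =
    ghost O′ O′ , (⁅⁆-⊆ y∈O′ , ⊆-refl , size-O′≤k) , (begin
      f * 1 + f * size R + K * size (O′ ∖ O′)
        ≡⟨ cong (λ u → f * 1 + f * size R + K * u) (size-∖-self O′) ⟩
      f * 1 + f * size R + K * 0
        ≡⟨ solve 3 (λ f r K → f :* con 1 :+ f :* r :+ K :* con 0 := f :* con 1 :+ f :* r) refl f (size R) K ⟩
      f * 1 + f * size R
        ≤⟨ +-monoʳ-≤ (f * 1) (*-monoʳ-≤ f size-R≤K) ⟩
      f * 1 + f * K
        ≡⟨ cong (f * 1 +_) (*-comm f K) ⟩
      f * 1 + K * f
        ≤⟨ +-monoʳ-≤ (f * 1) (*-monoʳ-≤ K (flush-paid g K≤size y∉R y∈O′ tracks)) ⟩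
      f * 1 + K * (size (O′ ∖ O) + unpaid g)
        ≡⟨ solve 4 (λ f d K u → f :* con 1 :+ K :* (d :+ u) := K :* d :+ f :* con 1 :+ K :* u)
                 refl f (size (O′ ∖ O)) K (unpaid g) ⟩
      K * size (O′ ∖ O) + f * 1 + K * unpaid g
        ≡⟨ cong (λ s → K * size (O′ ∖ O) + f * s + K * unpaid g) (size-⁅⁆ y) ⟨
      K * size (O′ ∖ O) + f * size ⁅ y ⁆ + K * unpaid g ∎)
    where
    open ≤-Reasoning
    K≤size : K ≤ size R
    K≤size = ≮⇒≥ (λ size<K → subst T lt (<⇒<ᵇ size<K))

-- The online algorithm

Lists : ℕ → Set
Lists n = Fin n → Subset n

record State (m n : ℕ) : Set where
  constructor state
  field
    lists : Lists n
    cache : Cache m n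

open State

module Algorithm {m n : ℕ} (K : ℕ) where

  pushes : Lists n → Fin n → Fin n → Fin n → Bool
  pushes L u v x = (x == u ∧ not (L x v)) ∨ (x == v ∧ not (L x u))

  relist : Lists n → Fin n → Fin n → Lists n
  relist L u v x =
    if x == u ∧ not (L x v) then push K (L x) v
    else if x == v ∧ not (L x u) then push K (L x) u
    else L x

  keepMutual : Lists n → Fin n → Maybe (Fin n) → Maybe (Fin n)
  keepMutual L x nothing  = nothing
  keepMutual L x (just y) = if L x y ∧ L y x then just y else nothing

  restrict : Lists n → Cache m n → Cache m n
  restrict L C c x = keepMutual L x (C c x)

  addEdge : Cache m n → Fin m → Fin n → Fin n → Cache m n
  addEdge C c₀ u v c x =
    if c == c₀ then (if x == u then just v else if x == v then just u else C c x) else C c x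

  FreeAt : Cache m n → Fin n → Fin n → Fin m → Set
  FreeAt C u v c = C c u ≡ nothing × C c v ≡ nothing

  freeAt? : ∀ C u v → Decidable (FreeAt C u v)
  freeAt? C u v c = (C c u ≟ₘ nothing) ×-dec (C c v ≟ₘ nothing)

  fault : Lists n → Cache m n → Fin n → Fin n → Cache m n
  fault L C u v with any? (freeAt? (restrict L C) u v)
  ... | yes (c , _) = addEdge (restrict L C) c u v
  ... | no _        = restrict L C

  recache : Lists n → Cache m n → Fin n → Fin n → Cache m n
  recache L C u v = if adj C u v then C else fault L C u v

  step : State m n → Edge n → State m n
  step s ((u , v) , _) = state (relist (lists s) u v) (recache (relist (lists s) u v) (cache s) u v)

  run : List (Edge n) → State m n
  run []       = state (λ _ → ∅) emptyCache
  run (r ∷ rs) = step (run rs) r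

  online : OnlineAlg m n
  online = cache ∘ run

  relist-mutual : ∀ L {u v} → u ≢ v → L u v ≡ true → L v u ≡ true → ∀ x w → relist L u v x w ≡ L x w
  relist-mutual L {u} {v} u≢v uv vu x w with x ≟ u
  ... | yes refl rewrite uv | ==-false u≢v = refl
  ... | no _ with x ≟ v
  ...   | yes refl rewrite vu = refl
  ...   | no _     = refl

  relist-∋ᵘᵛ : ∀ L {u v} → u ≢ v → relist L u v u v ≡ true
  relist-∋ᵘᵛ L {u} {v} u≢v rewrite ==-refl u with L u v in uv
  ... | false = push-∋ K (L u) v
  ... | true rewrite ==-false u≢v = uv

  relist-∋ᵛᵘ : ∀ L {u v} → u ≢ v → relist L u v v u ≡ true
  relist-∋ᵛᵘ L {u} {v} u≢v rewrite ==-false (u≢v ∘ sym) | ==-refl v with L v u in vu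
  ... | false = push-∋ K (L v) u
  ... | true  = vu

  relist-⊆ : ∀ L u v x y → relist L u v x y ≡ true →
             L x y ≡ true ⊎ (x ≡ u × y ≡ v) ⊎ (x ≡ v × y ≡ u)
  relist-⊆ L u v x y e with x == u ∧ not (L x v) in pushᵘ
  ... | true with ∪-⁅⁆-elim (L x) y (push-⊆ K (L x) v y e)
  ...   | inj₁ xy  = inj₁ xy
  ...   | inj₂ y≡v = inj₂ (inj₁ (==-sound (∧-conicalˡ _ _ pushᵘ) , y≡v))
  relist-⊆ L u v x y e | false with x == v ∧ not (L x u) in pushᵛ
  ...   | true with ∪-⁅⁆-elim (L x) y (push-⊆ K (L x) u y e)
  ...     | inj₁ xy  = inj₁ xy
  ...     | inj₂ y≡u = inj₂ (inj₂ (==-sound (∧-conicalˡ _ _ pushᵛ) , y≡u))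
  relist-⊆ L u v x y e | false | false = inj₁ e

  size-relist≤ : 1 ≤ K → ∀ L u v → (∀ x → size (L x) ≤ K) → ∀ x → size (relist L u v x) ≤ K
  size-relist≤ 1≤K L u v size≤K x with x == u ∧ not (L x v)
  ... | true = size-push≤ K (L x) v 1≤K (size≤K x)
  ... | false with x == v ∧ not (L x u)
  ...   | true  = size-push≤ K (L x) u 1≤K (size≤K x)
  ...   | false = size≤K x

  some-push : ∀ L {u v} → u ≢ v → (L u v ∧ L v u) ≡ false → 1 ≤ ∑[ x < n ] 𝟙 (pushes L u v x)
  some-push L {u} {v} u≢v not-mutual with L u v in uv
  ... | false = ≤-trans pushᵘ (≤-sum (λ x → 𝟙 (pushes L u v x)) u)
    where
    pushᵘ : 1 ≤ 𝟙 (pushes L u v u)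
    pushᵘ rewrite ==-refl u | uv = ≤-refl
  ... | true  = ≤-trans pushᵛ (≤-sum (λ x → 𝟙 (pushes L u v x)) v)
    where
    pushᵛ : 1 ≤ 𝟙 (pushes L u v v)
    pushᵛ rewrite ==-false (u≢v ∘ sym) | ==-refl v | not-mutual = ≤-refl

  restrict-sound : ∀ L C c x y → restrict L C c x ≡ just y → C c x ≡ just y × (L x y ∧ L y x) ≡ true
  restrict-sound L C c x y e with C c x
  ... | just z with L x z ∧ L z x in both
  restrict-sound L C c x y refl | just z | true = refl , both

  restrict-complete : ∀ L C c x y → C c x ≡ just y → (L x y ∧ L y x) ≡ true → restrict L C c x ≡ just y
  restrict-complete L C c x y e both rewrite e | both = refl

  restrict-valid : ∀ L C → ValidCache C → ValidCache (restrict L C)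
  restrict-valid L C valid c x y e with restrict-sound L C c x y e
  ... | e′ , both =
    proj₁ (valid c x y e′) ,
    restrict-complete L C c y x (proj₂ (valid c x y e′)) (trans (∧-comm (L y x) (L x y)) both)

  NewEdge : Fin m → Fin m → Fin n → Fin n → Fin n → Fin n → Set
  NewEdge c c₀ x y u v = (c ≡ c₀ × x ≡ u × y ≡ v) ⊎ (c ≡ c₀ × x ≡ v × y ≡ u)

  addEdge-cases : ∀ C c₀ u v c x y → addEdge C c₀ u v c x ≡ just y → NewEdge c c₀ x y u v ⊎ C c x ≡ just y
  addEdge-cases C c₀ u v c x y e with c ≟ c₀
  ... | no _ = inj₂ e
  ... | yes refl with x ≟ u
  addEdge-cases C c₀ u v c x y refl | yes refl | yes refl = inj₁ (inj₁ (refl , refl , refl))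
  ... | no _ with x ≟ v
  addEdge-cases C c₀ u v c x y refl | yes refl | no _ | yes refl = inj₁ (inj₂ (refl , refl , refl))
  ... | no _ = inj₂ e

  addEdge-keeps : ∀ C c₀ u v → FreeAt C u v c₀ → ∀ c x y → C c x ≡ just y → addEdge C c₀ u v c x ≡ just y
  addEdge-keeps C c₀ u v (u-free , v-free) c x y e with c ≟ c₀
  ... | no _ = e
  ... | yes refl with x ≟ u
  ...   | yes refl with () ← trans (sym u-free) e
  ...   | no _ with x ≟ v
  ...     | yes refl with () ← trans (sym v-free) e
  ...     | no _ = e

  addEdge-uv : ∀ C c₀ u v → addEdge C c₀ u v c₀ u ≡ just v
  addEdge-uv C c₀ u v rewrite ==-refl c₀ | ==-refl u = refl

  addEdge-vu : ∀ C c₀ u v → u ≢ v → addEdge C c₀ u v c₀ v ≡ just u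
  addEdge-vu C c₀ u v u≢v rewrite ==-refl c₀ | ==-false (u≢v ∘ sym) | ==-refl v = refl

  addEdge-valid : ∀ C c₀ u v → u ≢ v → FreeAt C u v c₀ → ValidCache C → ValidCache (addEdge C c₀ u v)
  addEdge-valid C c₀ u v u≢v free valid c x y e with addEdge-cases C c₀ u v c x y e
  ... | inj₁ (inj₁ (refl , refl , refl)) = u≢v , addEdge-vu C c₀ u v u≢v
  ... | inj₁ (inj₂ (refl , refl , refl)) = u≢v ∘ sym , addEdge-uv C c₀ u v
  ... | inj₂ e′ = proj₁ (valid c x y e′) , addEdge-keeps C c₀ u v free c y x (proj₂ (valid c x y e′))

  record Invariant (s : State m n) : Set where
    field
      valid        : ValidCache (cache s)
      cache≡mutual : ∀ x y → adj (cache s) x y ≡ (lists s x y ∧ lists s y x)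
      size-lists≤K : ∀ x → size (lists s x) ≤ K
      simple       : ∀ x y → ∑[ c < m ] 𝟙 (cache s c x ≐ y) ≤ 1

  open Invariant public

  module Fault (1≤K : 1 ≤ K) (K+K≤1+m : K + K ≤ suc m) (s : State m n) {u v : Fin n} (u≢v : u ≢ v)
               (inv : Invariant s) (miss : adj (cache s) u v ≡ false) where

    L′ : Lists n
    L′ = relist (lists s) u v

    C′ : Cache m n
    C′ = restrict L′ (cache s)

    u≁v : ∀ c → cache s c u ≢ just v
    u≁v = adj-false (cache s) miss

    v≁u : ∀ c → cache s c v ≢ just u
    v≁u c e = u≁v c (proj₂ (valid inv c v u e))

    -- Each colour used at a in C′ carries its own neighbour from L′ a, and never b.
    busy-colours< : ∀ a b → (∀ c → cache s c a ≢ just b) → L′ a b ≡ true →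
                    ∑[ c < m ] 𝟙 (is-just (C′ c a)) + 1 ≤ K
    busy-colours< a b a≁b b∈L′a = begin
      ∑[ c < m ] 𝟙 (is-just (C′ c a)) + 1
        ≡⟨ cong (_+ 1) (sum-cong-≗ (λ c → sum-≐ (C′ c a))) ⟨
      ∑[ c < m ] ∑[ w < n ] 𝟙 (C′ c a ≐ w) + 1
        ≡⟨ cong (_+ 1) (∑-comm (λ c w → 𝟙 (C′ c a ≐ w))) ⟩
      ∑[ w < n ] ∑[ c < m ] 𝟙 (C′ c a ≐ w) + 1
        ≤⟨ +-monoˡ-≤ 1 (sum-mono-≤ colours≤) ⟩
      size (L′ a ∖ ⁅ b ⁆) + 1
        ≤⟨ size-∖-⁅⁆ (L′ a) b b∈L′a ⟩
      size (L′ a)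
        ≤⟨ size-relist≤ 1≤K (lists s) u v (size-lists≤K inv) a ⟩
      K ∎
      where
      open ≤-Reasoning
      colours≤ : ∀ w → ∑[ c < m ] 𝟙 (C′ c a ≐ w) ≤ 𝟙 ((L′ a ∖ ⁅ b ⁆) w)
      colours≤ w = sum-𝟙≤𝟙 (λ c → C′ c a ≐ w) _ (≤-trans (sum-mono-≤ restricted) (simple inv a w)) in-list
        where
        restricted : ∀ c → 𝟙 (C′ c a ≐ w) ≤ 𝟙 (cache s c a ≐ w)
        restricted c with C′ c a ≐ w in e
        ... | false = z≤n
        ... | true rewrite ≐-complete (proj₁ (restrict-sound L′ (cache s) c a w (≐-sound e))) = ≤-refl
        in-list : ∀ c → (C′ c a ≐ w) ≡ true → (L′ a ∖ ⁅ b ⁆) w ≡ true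
        in-list c e with restrict-sound L′ (cache s) c a w (≐-sound e) | w ≟ b
        ... | e′ , _    | yes refl = ⊥-elim (a≁b c e′)
        ... | _ , both  | no _     = trans (∧-identityʳ _) (∧-conicalˡ _ _ both)

    -- u and v each use at most K − 1 colours of C′, and 2 (K − 1) < m.
    ¬¬free-colour : ¬ ¬ (∃[ c ] FreeAt C′ u v c)
    ¬¬free-colour none = <-irrefl refl (≤-trans colours<m m≤colours)
      where
      Bᵘ Bᵛ : ℕ
      Bᵘ = ∑[ c < m ] 𝟙 (is-just (C′ c u))
      Bᵛ = ∑[ c < m ] 𝟙 (is-just (C′ c v))
      busy : ∀ (a b : Maybe (Fin n)) → ¬ (a ≡ nothing × b ≡ nothing) → 1 ≤ 𝟙 (is-just a) + 𝟙 (is-just b)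
      busy (just _) _        _     = s≤s z≤n
      busy nothing  (just _) _     = s≤s z≤n
      busy nothing  nothing  ¬free = ⊥-elim (¬free (refl , refl))
      m≤colours : m ≤ Bᵘ + Bᵛ
      m≤colours = begin
        m                                                       ≡⟨ *-identityʳ m ⟨
        m * 1                                                   ≡⟨ sum-const m 1 ⟨
        ∑[ c < m ] 1                                            ≤⟨ sum-mono-≤ (λ c → busy (C′ c u) (C′ c v) (λ free → none (c , free))) ⟩
        ∑[ c < m ] (𝟙 (is-just (C′ c u)) + 𝟙 (is-just (C′ c v))) ≡⟨ ∑-distrib-+ (λ c → 𝟙 (is-just (C′ c u))) (λ c → 𝟙 (is-just (C′ c v))) ⟩
        Bᵘ + Bᵛ                                                 ∎
        where open ≤-Reasoning
      colours<m : suc (Bᵘ + Bᵛ) ≤ m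
      colours<m = +-cancelʳ-≤ 1 (suc (Bᵘ + Bᵛ)) m (begin
        suc (Bᵘ + Bᵛ) + 1       ≡⟨ solve 2 (λ a b → con 1 :+ (a :+ b) :+ con 1 := (a :+ con 1) :+ (b :+ con 1)) refl Bᵘ Bᵛ ⟩
        (Bᵘ + 1) + (Bᵛ + 1)     ≤⟨ +-mono-≤ (busy-colours< u v u≁v (relist-∋ᵘᵛ (lists s) u≢v))
                                            (busy-colours< v u v≁u (relist-∋ᵛᵘ (lists s) u≢v)) ⟩
        K + K                   ≤⟨ K+K≤1+m ⟩
        suc m                   ≡⟨ +-comm 1 m ⟩
        m + 1                   ∎)
        where
        open ≤-Reasoning
        open +-*-Solver using (solve; _:+_; _:*_; _:=_; con)

    fault-adds : Σ (Fin m) λ c₀ → FreeAt C′ u v c₀ × fault L′ (cache s) u v ≡ addEdge C′ c₀ u v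
    fault-adds with any? (freeAt? C′ u v)
    ... | yes (c₀ , free) = c₀ , free , refl
    ... | no none         = ⊥-elim (¬¬free-colour none)

    c₀ : Fin m
    c₀ = proj₁ fault-adds

    C″ : Cache m n
    C″ = addEdge C′ c₀ u v

    C″-cases : ∀ c x y → C″ c x ≡ just y → NewEdge c c₀ x y u v ⊎ cache s c x ≡ just y
    C″-cases c x y e with addEdge-cases C′ c₀ u v c x y e
    ... | inj₁ new = inj₁ new
    ... | inj₂ e′  = inj₂ (proj₁ (restrict-sound L′ (cache s) c x y e′))

    C″-keeps : ∀ c x y → cache s c x ≡ just y → (L′ x y ∧ L′ y x) ≡ true → C″ c x ≡ just y
    C″-keeps c x y e both =
      addEdge-keeps C′ c₀ u v (proj₁ (proj₂ fault-adds)) c x y (restrict-complete L′ (cache s) c x y e both)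

    valid″ : ValidCache C″
    valid″ = addEdge-valid C′ c₀ u v u≢v (proj₁ (proj₂ fault-adds)) (restrict-valid L′ (cache s) (valid inv))

    C″≡mutual : ∀ x y → adj C″ x y ≡ (L′ x y ∧ L′ y x)
    C″≡mutual x y = ⇔→≡ (mk⇔ cached⇒mutual mutual⇒cached)
      where
      cached⇒mutual : adj C″ x y ≡ true → (L′ x y ∧ L′ y x) ≡ true
      cached⇒mutual e with c , e′ ← adj-elim C″ e with addEdge-cases C′ c₀ u v c x y e′
      ... | inj₁ (inj₁ (refl , refl , refl)) = cong₂ _∧_ (relist-∋ᵘᵛ (lists s) u≢v) (relist-∋ᵛᵘ (lists s) u≢v)
      ... | inj₁ (inj₂ (refl , refl , refl)) = cong₂ _∧_ (relist-∋ᵛᵘ (lists s) u≢v) (relist-∋ᵘᵛ (lists s) u≢v)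
      ... | inj₂ e″ = proj₂ (restrict-sound L′ (cache s) c x y e″)
      was-cached : (lists s x y ∧ lists s y x) ≡ true → (L′ x y ∧ L′ y x) ≡ true → adj C″ x y ≡ true
      was-cached before after with c , e ← adj-elim (cache s) (trans (cache≡mutual inv x y) before) =
        adj-intro C″ c (C″-keeps c x y e after)
      mutual⇒cached : (L′ x y ∧ L′ y x) ≡ true → adj C″ x y ≡ true
      mutual⇒cached both with relist-⊆ (lists s) u v x y (∧-conicalˡ _ _ both)
      ... | inj₂ (inj₁ (refl , refl)) = adj-intro C″ c₀ (addEdge-uv C′ c₀ u v)
      ... | inj₂ (inj₂ (refl , refl)) = adj-intro C″ c₀ (addEdge-vu C′ c₀ u v u≢v)
      ... | inj₁ xy with relist-⊆ (lists s) u v y x (∧-conicalʳ _ _ both)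
      ...   | inj₂ (inj₁ (refl , refl)) = adj-intro C″ c₀ (addEdge-vu C′ c₀ u v u≢v)
      ...   | inj₂ (inj₂ (refl , refl)) = adj-intro C″ c₀ (addEdge-uv C′ c₀ u v)
      ...   | inj₁ yx = was-cached (cong₂ _∧_ xy yx) both

    simple″ : ∀ x y → ∑[ c < m ] 𝟙 (C″ c x ≐ y) ≤ 1
    simple″ x y with (x ≟ u ×-dec y ≟ v) ⊎-dec (x ≟ v ×-dec y ≟ u)
    ... | no not-uv = ≤-trans (sum-mono-≤ old-only) (simple inv x y)
      where
      old-only : ∀ c → 𝟙 (C″ c x ≐ y) ≤ 𝟙 (cache s c x ≐ y)
      old-only c with C″ c x ≐ y in e
      ... | false = z≤n
      ... | true with C″-cases c x y (≐-sound e)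
      ...   | inj₁ (inj₁ (_ , x≡u , y≡v)) = ⊥-elim (not-uv (inj₁ (x≡u , y≡v)))
      ...   | inj₁ (inj₂ (_ , x≡v , y≡u)) = ⊥-elim (not-uv (inj₂ (x≡v , y≡u)))
      ...   | inj₂ e′ rewrite ≐-complete e′ = ≤-refl
    ... | yes uv = ≤-reflexive (trans (sum-supported _ c₀ only-c₀) (cong 𝟙 (≐-complete (e₀ uv))))
      where
      e₀ : (x ≡ u × y ≡ v) ⊎ (x ≡ v × y ≡ u) → C″ c₀ x ≡ just y
      e₀ (inj₁ (refl , refl)) = addEdge-uv C′ c₀ u v
      e₀ (inj₂ (refl , refl)) = addEdge-vu C′ c₀ u v u≢v
      not-old : ∀ c → (x ≡ u × y ≡ v) ⊎ (x ≡ v × y ≡ u) → cache s c x ≢ just y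
      not-old c (inj₁ (refl , refl)) = u≁v c
      not-old c (inj₂ (refl , refl)) = v≁u c
      only-c₀ : ∀ c → c ≢ c₀ → 𝟙 (C″ c x ≐ y) ≡ 0
      only-c₀ c c≢c₀ with C″ c x ≐ y in e
      ... | false = refl
      ... | true with C″-cases c x y (≐-sound e)
      ...   | inj₁ (inj₁ (c≡c₀ , _)) = ⊥-elim (c≢c₀ c≡c₀)
      ...   | inj₁ (inj₂ (c≡c₀ , _)) = ⊥-elim (c≢c₀ c≡c₀)
      ...   | inj₂ e′ = ⊥-elim (not-old c uv e′)

    invariant″ : Invariant (state L′ C″)
    invariant″ = record
      { valid        = valid″
      ; cache≡mutual = C″≡mutual
      ; size-lists≤K = size-relist≤ 1≤K (lists s) u v (size-lists≤K inv)
      ; simple       = simple″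
      }

    fault-cost≤1 : added (cache s) C″ ≤ 1
    fault-cost≤1 = begin
      added (cache s) C″                               ≡⟨ added≡sum (cache s) C″ ⟩
      ∑[ c < m ] ∑[ x < n ] ∑[ y < n ] 𝟙 (new c x y)
        ≡⟨ sum-supported _ c₀ (λ c c≢c₀ → sum-zero λ x → sum-zero λ y → off c x y (c≢c₀ ∘ proj₁)) ⟩
      ∑[ x < n ] ∑[ y < n ] 𝟙 (new c₀ x y)
        ≡⟨ sum-supported _ p (λ x x≢p → sum-zero λ y → off c₀ x y (x≢p ∘ proj₁ ∘ proj₂)) ⟩
      ∑[ y < n ] 𝟙 (new c₀ p y)
        ≡⟨ sum-supported _ q (λ y y≢q → off c₀ p y (y≢q ∘ proj₂ ∘ proj₂)) ⟩
      𝟙 (new c₀ p q)                                   ≤⟨ 𝟙≤1 (new c₀ p q) ⟩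
      1                                                ∎
      where
      open ≤-Reasoning
      new : Fin m → Fin n → Fin n → Bool
      new c x y = does (x <? y) ∧ (C″ c x ≐ y) ∧ not (cache s c x ≐ y)
      p q : Fin n
      p = if does (u <? v) then u else v
      q = if does (u <? v) then v else u
      only-pq : ∀ c x y → new c x y ≡ true → c ≡ c₀ × x ≡ p × y ≡ q
      only-pq c x y e with does (x <? y) in x<y | C″ c x ≐ y in e₁ | cache s c x ≐ y in e₂
      only-pq c x y () | false | _     | _
      only-pq c x y () | true  | false | _
      only-pq c x y () | true  | true  | true
      ... | true | true | false with C″-cases c x y (≐-sound e₁)
      ...   | inj₂ e′ with () ← trans (sym e₂) (≐-complete e′)
      ...   | inj₁ (inj₁ (refl , refl , refl)) rewrite x<y = refl , refl , refl
      ...   | inj₁ (inj₂ (refl , refl , refl)) with does (u <? v) in u<v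
      ...     | true  = ⊥-elim (<-asym (does-true (v <? u) x<y) (does-true (u <? v) u<v))
      ...     | false = refl , refl , refl
      off : ∀ c x y → ¬ (c ≡ c₀ × x ≡ p × y ≡ q) → 𝟙 (new c x y) ≡ 0
      off c x y ¬pq with new c x y in e
      ... | false = refl
      ... | true  = ⊥-elim (¬pq (only-pq c x y e))

  module _ (1≤K : 1 ≤ K) (K+K≤1+m : K + K ≤ suc m) where

    step-invariant : ∀ s r → Invariant s → Invariant (step s r)
    step-invariant s ((u , v) , u≢v) inv with adj (cache s) u v in hit
    ... | true = record
      { valid        = valid inv
      ; cache≡mutual = λ x y → trans (cache≡mutual inv x y) (sym (cong₂ _∧_ (unchanged x y) (unchanged y x)))
      ; size-lists≤K = λ x → ≤-trans (≤-reflexive (sum-cong-≗ (cong 𝟙 ∘ unchanged x))) (size-lists≤K inv x)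
      ; simple       = simple inv
      }
      where
      uv∧vu = trans (sym (cache≡mutual inv u v)) hit
      unchanged = relist-mutual (lists s) u≢v (∧-conicalˡ _ _ uv∧vu) (∧-conicalʳ _ _ uv∧vu)
    ... | false = subst (Invariant ∘ state L′) (sym (proj₂ (proj₂ fault-adds))) invariant″
      where open Fault 1≤K K+K≤1+m s u≢v inv hit

    step-serves : ∀ s r → Invariant s → Serves (cache (step s r)) r
    step-serves s ((u , v) , u≢v) inv with adj (cache s) u v in hit
    ... | true  = adj-elim (cache s) hit
    ... | false = c₀ , subst (λ C → C c₀ u ≡ just v) (sym (proj₂ (proj₂ fault-adds))) (addEdge-uv C′ c₀ u v)
      where open Fault 1≤K K+K≤1+m s u≢v inv hit

    step-cost : ∀ s {u v} (u≢v : u ≢ v) → Invariant s →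
                added (cache s) (cache (step s ((u , v) , u≢v))) ≤ ∑[ x < n ] 𝟙 (pushes (lists s) u v x)
    step-cost s {u} {v} u≢v inv with adj (cache s) u v in hit
    ... | true  = ≤-trans (≤-reflexive (added-self (cache s))) z≤n
    ... | false = begin
      added (cache s) (fault L′ (cache s) u v) ≡⟨ cong (added (cache s)) (proj₂ (proj₂ fault-adds)) ⟩
      added (cache s) C″                       ≤⟨ fault-cost≤1 ⟩
      1                                        ≤⟨ some-push (lists s) u≢v (trans (sym (cache≡mutual inv u v)) hit) ⟩
      ∑[ x < n ] 𝟙 (pushes (lists s) u v x)    ∎
      where
      open Fault 1≤K K+K≤1+m s u≢v inv hit
      open ≤-Reasoning

    invariant : ∀ rs → Invariant (run rs)
    invariant []       = record
      { valid        = λ _ _ _ ()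
      ; cache≡mutual = adj-empty {m}
      ; size-lists≤K = λ x → ≤-trans (≤-reflexive (size-∅ {n})) z≤n
      ; simple       = λ x y → ≤-trans (≤-reflexive (sum-zero {m} λ _ → refl)) z≤n
      }
    invariant (r ∷ rs) = step-invariant (run rs) r (invariant rs)

    online-isOnline : IsOnlineAlg online
    online-isOnline r rs = valid (invariant (r ∷ rs)) , step-serves (run rs) r (invariant rs)

-- Amortised analysis

module Competitiveness (n k m K f : ℕ) (f+k≤1+K : f + k ≤ suc K) (1≤K : 1 ≤ K) (K+K≤1+m : K + K ≤ suc m) where

  open Algorithm {m} {n} K
  open Amortisation {n} k K f f+k≤1+K
  open +-*-Solver using (solve; _:+_; _:*_; _:=_; con)

  TracksAll : State m n → Cache k n → (Fin n → Ghost n) → Set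
  TracksAll s P G = ∀ x → Tracks k (lists s x) (adj P x) (G x)

  node-amortised : ∀ s (P C : Cache k n) {u v} (u≢v : u ≢ v) G → Invariant s → Serves C ((u , v) , u≢v) →
    ValidCache C → TracksAll s P G → ∀ x →
    Amortised (lists s x) (relist (lists s) u v x) (adj P x) (adj C x) (G x) (𝟙 (pushes (lists s) u v x))
  node-amortised s P C {u} {v} u≢v G inv (c , uv∈C) validC tracks x with x == u ∧ not (lists s x v) in pushᵘ
  ... | true = amortised-push (G x) (not-injective (∧-conicalʳ _ _ pushᵘ))
      (subst (λ z → adj C z v ≡ true) (sym (==-sound (∧-conicalˡ _ _ pushᵘ))) (adj-intro C c uv∈C))
      (size-lists≤K inv x) (size-adj≤ C x) (tracks x)
  ... | false with x == v ∧ not (lists s x u) in pushᵛ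
  ...   | true = amortised-push (G x) (not-injective (∧-conicalʳ _ _ pushᵛ))
      (subst (λ z → adj C z u ≡ true) (sym (==-sound (∧-conicalˡ _ _ pushᵛ))) (adj-intro C c (proj₂ (validC c u v uv∈C))))
      (size-lists≤K inv x) (size-adj≤ C x) (tracks x)
  ...   | false = amortised-idle (adj C x) (G x) (tracks x)

  listTotal : State m n → ℕ
  listTotal s = ∑[ x < n ] size (lists s x)

  unpaidTotal : (Fin n → Ghost n) → ℕ
  unpaidTotal G = ∑[ x < n ] unpaid (G x)

  step-amortised : ∀ s (P C : Cache k n) r G → Invariant s → ValidCache C → Serves C r → TracksAll s P G →
    Σ (Fin n → Ghost n) λ G′ → TracksAll (step s r) C G′ ×
      f * added (cache s) (cache (step s r)) + f * listTotal s + K * unpaidTotal G′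
        ≤ K * ∑[ x < n ] size (newNbrs P C x) + f * listTotal (step s r) + K * unpaidTotal G
  step-amortised s P C r@((u , v) , u≢v) G inv validC serves tracks =
    proj₁ ∘ per-node , proj₁ ∘ proj₂ ∘ per-node , (begin
      f * added (cache s) (cache s′) + f * listTotal s + K * unpaidTotal G′
        ≤⟨ +-monoˡ-≤ (K * unpaidTotal G′) (+-monoˡ-≤ (f * listTotal s)
             (*-monoʳ-≤ f (step-cost 1≤K K+K≤1+m s u≢v inv))) ⟩
      f * sum pushed + f * listTotal s + K * unpaidTotal G′
        ≡⟨ sum-linear₃ pushed (size ∘ lists s) (unpaid ∘ G′) f f K ⟨
      ∑[ x < n ] (f * pushed x + f * size (lists s x) + K * unpaid (G′ x))
        ≤⟨ sum-mono-≤ (proj₂ ∘ proj₂ ∘ per-node) ⟩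
      ∑[ x < n ] (K * size (newNbrs P C x) + f * size (lists s′ x) + K * unpaid (G x))
        ≡⟨ sum-linear₃ (size ∘ newNbrs P C) (size ∘ lists s′) (unpaid ∘ G) K f K ⟩
      K * ∑[ x < n ] size (newNbrs P C x) + f * listTotal s′ + K * unpaidTotal G ∎)
    where
    open ≤-Reasoning
    s′ = step s r
    pushed : Fin n → ℕ
    pushed x = 𝟙 (pushes (lists s) u v x)
    per-node = node-amortised s P C u≢v G inv serves validC tracks
    G′ : Fin n → Ghost n
    G′ = proj₁ ∘ per-node

  newTotal : Cache k n → List (Cache k n) → ℕ
  newTotal P []       = 0
  newTotal P (C ∷ Cs) = ∑[ x < n ] size (newNbrs P C x) + newTotal C Cs

  newTotal≤ : ∀ {σ S} (P : Cache k n) → ValidCache P → FeasibleSched σ S → newTotal P S ≤ 2 * schedCost P S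
  newTotal≤ P validP [] = z≤n
  newTotal≤ {S = C ∷ S} P validP ((validC , _) ∷ feasible) = begin
    ∑[ x < n ] size (newNbrs P C x) + newTotal C S ≤⟨ +-mono-≤ (sum-size-newNbrs≤ validP validC) (newTotal≤ C validC feasible) ⟩
    2 * added P C + 2 * schedCost C S              ≡⟨ *-distribˡ-+ 2 (added P C) (schedCost C S) ⟨
    2 * (added P C + schedCost C S)                ∎
    where open ≤-Reasoning

  telescope : ∀ σ S rs (P : Cache k n) G → TracksAll (run rs) P G → FeasibleSched σ S →
    f * schedCost (cache (run rs)) (onlineStates online rs σ) + f * listTotal (run rs)
      ≤ K * newTotal P S + f * (n * K) + K * unpaidTotal G
  telescope [] [] rs P G _ [] = begin
    f * 0 + f * listTotal (run rs)       ≡⟨ cong (_+ f * listTotal (run rs)) (*-zeroʳ f) ⟩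
    f * listTotal (run rs)               ≤⟨ *-monoʳ-≤ f (≤-trans (sum-mono-≤ (size-lists≤K (invariant 1≤K K+K≤1+m rs))) (≤-reflexive (sum-const n K))) ⟩
    f * (n * K)                          ≤⟨ m≤m+n _ _ ⟩
    f * (n * K) + K * unpaidTotal G      ≡⟨ cong (λ z → z + f * (n * K) + K * unpaidTotal G) (*-zeroʳ K) ⟨
    K * 0 + f * (n * K) + K * unpaidTotal G ∎
    where open ≤-Reasoning
  telescope (r ∷ σ) (C ∷ S) rs P G tracks ((validC , serves) ∷ feasible)
    with G′ , tracks′ , step≤ ← step-amortised (run rs) P C r G (invariant 1≤K K+K≤1+m rs) validC serves tracks =
    +-cancelʳ-≤ X _ _ (begin
      f * (A + R) + f * Λ + X
        ≡⟨ solve 7 (λ f A R Λ Λ′ K U′ → f :* (A :+ R) :+ f :* Λ :+ (f :* Λ′ :+ K :* U′)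
                                      := (f :* A :+ f :* Λ :+ K :* U′) :+ (f :* R :+ f :* Λ′))
                 refl f A R Λ Λ′ K U′ ⟩
      (f * A + f * Λ + K * U′) + (f * R + f * Λ′)
        ≤⟨ +-mono-≤ step≤ (telescope σ S (r ∷ rs) C G′ tracks′ feasible) ⟩
      (K * N + f * Λ′ + K * U) + (K * newTotal C S + B + K * U′)
        ≡⟨ solve 8 (λ f K N Λ′ U N′ B U′ → (K :* N :+ f :* Λ′ :+ K :* U) :+ (K :* N′ :+ B :+ K :* U′)
                                        := K :* (N :+ N′) :+ B :+ K :* U :+ (f :* Λ′ :+ K :* U′))
                 refl f K N Λ′ U (newTotal C S) B U′ ⟩
      K * (N + newTotal C S) + B + K * U + X ∎)
    where
    open ≤-Reasoning
    s′ = run (r ∷ rs)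
    A = added (cache (run rs)) (cache s′)
    R = schedCost (cache s′) (onlineStates online (r ∷ rs) σ)
    Λ = listTotal (run rs)
    Λ′ = listTotal s′
    U = unpaidTotal G
    U′ = unpaidTotal G′
    N = ∑[ x < n ] size (newNbrs P C x)
    B = f * (n * K)
    X = f * Λ′ + K * U′

  competitive : ∀ σ S → FeasibleSched σ S → f * onlineCost online σ ≤ 2 * K * schedCost emptyCache S + f * (n * K)
  competitive σ S feasible = begin
    f * onlineCost online σ
      ≤⟨ m≤m+n _ _ ⟩
    f * onlineCost online σ + f * listTotal (run [])
      ≤⟨ telescope σ S [] emptyCache (λ _ → ghost ∅ ∅) tracks₀ feasible ⟩
    K * newTotal emptyCache S + f * (n * K) + K * unpaidTotal (λ _ → ghost ∅ ∅)
      ≡⟨ cong (λ u → K * newTotal emptyCache S + f * (n * K) + K * u) (sum-zero {n} λ _ → size-∅ {n}) ⟩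
    K * newTotal emptyCache S + f * (n * K) + K * 0
      ≤⟨ +-monoˡ-≤ (K * 0) (+-monoˡ-≤ (f * (n * K)) (*-monoʳ-≤ K (newTotal≤ emptyCache (λ _ _ _ ()) feasible))) ⟩
    K * (2 * O) + f * (n * K) + K * 0
      ≡⟨ solve 3 (λ K O B → K :* (con 2 :* O) :+ B :+ K :* con 0 := con 2 :* K :* O :+ B) refl K O (f * (n * K)) ⟩
    2 * K * O + f * (n * K) ∎
    where
    open ≤-Reasoning
    O = schedCost emptyCache S
    tracks₀ : TracksAll (run []) emptyCache (λ _ → ghost ∅ ∅)
    tracks₀ x = (λ _ ()) , (λ w e → trans (sym (adj-empty {k} x w)) e) , ≤-trans (≤-reflexive (size-∅ {n})) z≤n

-- Choice of the parameters, for k = suc k′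

module Parameters (k′ h : ℕ) (k′≤h : k′ ≤ h) where

  open +-*-Solver using (solve; _:+_; _:*_; _:=_; con)

  slack f K : ℕ
  slack = h + 3 ∸ suc k′
  f     = ⌊ slack /2⌋
  K     = f + k′

  slack+k′ : slack + k′ ≡ h + 2
  slack+k′ = suc-injective (begin
    suc (slack + k′)  ≡⟨ +-suc slack k′ ⟨
    slack + suc k′    ≡⟨ m∸n+n≡m (≤-trans (s≤s k′≤h) (≤-trans (≤-reflexive (+-comm 1 h)) (+-monoʳ-≤ h (s≤s z≤n)))) ⟩
    h + 3             ≡⟨ +-suc h 2 ⟩
    suc (h + 2)       ∎)
    where open ≡-Reasoning

  f+k≤1+K : f + suc k′ ≤ suc K
  f+k≤1+K = ≤-reflexive (+-suc f k′)

  1≤K : 1 ≤ K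
  1≤K = ≤-trans (⌊n/2⌋-mono 2≤slack) (m≤m+n f k′)
    where
    2≤slack : 2 ≤ slack
    2≤slack = +-cancelʳ-≤ k′ 2 slack (begin
      2 + k′      ≡⟨ +-comm 2 k′ ⟩
      k′ + 2      ≤⟨ +-monoˡ-≤ 2 k′≤h ⟩
      h + 2       ≡⟨ slack+k′ ⟨
      slack + k′  ∎)
      where open ≤-Reasoning

  K+K≤1+m : K + K ≤ suc (suc k′ + h)
  K+K≤1+m = begin
    (f + k′) + (f + k′)  ≡⟨ solve 2 (λ f k → (f :+ k) :+ (f :+ k) := (f :+ f) :+ k :+ k) refl f k′ ⟩
    (f + f) + k′ + k′    ≤⟨ +-monoˡ-≤ k′ (+-monoˡ-≤ k′ f+f≤slack) ⟩
    slack + k′ + k′      ≡⟨ cong (_+ k′) slack+k′ ⟩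
    h + 2 + k′           ≡⟨ solve 2 (λ h k → h :+ con 2 :+ k := con 1 :+ (con 1 :+ k :+ h)) refl h k′ ⟩
    suc (suc k′ + h)     ∎
    where
    open ≤-Reasoning
    f+f≤slack : f + f ≤ slack
    f+f≤slack = ≤-trans (+-monoʳ-≤ f (⌊n/2⌋≤⌈n/2⌉ slack)) (≤-reflexive (⌊n/2⌋+⌈n/2⌉≡n slack))

theorem27 : (n k h : ℕ) → 1 ≤ k → k ∸ 1 ≤ h →
    Σ (OnlineAlg (k + h) n) (λ A → IsOnlineAlg A ×
    ∃[ d ] ((σ : List (Edge n)) (S : List (Cache k n)) → FeasibleSched σ S →
    ⌊ h + 3 ∸ k /2⌋ * onlineCost A σ
    ≤ 2 * (⌊ h + 3 ∸ k /2⌋ + (k ∸ 1)) * schedCost emptyCache S + d))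
theorem27 n (suc k′) h _ k′≤h =
  Algorithm.online K , Algorithm.online-isOnline K 1≤K K+K≤1+m , f * (n * K) , competitive
  where
  open Parameters k′ h k′≤h
  open Competitiveness n (suc k′) (suc k′ + h) K f f+k≤1+K 1≤K K+K≤1+m
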